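{- Let $H$ be any connected graph of order at least $2$, and let $H\circ_2$ be its $2$-corona, of order $n=3|V(H)|$. Then $H\circ_2$ is twin-free and $\gamma^{\mathrm{ID}}(H\circ_2)=\frac{2n}{3}$.
   Context: All graphs are finite, simple and undirected. The $2$-corona $H\circ_2$ of a graph $H$ is the graph obtained from $H$ by adding, for each vertex $v$ of $H$, a new vertex-disjoint copy of the path $P_2$ and an edge joining $v$ to one end of that path. $N(v)$ and $N[v]$ denote open and closed neighbourhoods. A graph is twin-free if there are no two distinct vertices $u,v$ with $N(u)=N(v)$ or $N[u]=N[v]$. A set $C\subseteq V(G)$ is an identifying code if for every vertex $v$ the set $N[v]\cap C$ is nonempty and for every two distinct vertices $u,v$ we have $N[u]\cap C\neq N[v]\cap C$. $\gamma^{\mathrm{ID}}(G)$ is the minimum size of an identifying code of $G$. -}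

module Defs where

open import Data.Nat using (ℕ; _*_; _≤_)
open import Data.Bool using (Bool; true; false; _∨_)
open import Data.Fin using (Fin; zero; suc; remQuot; _≟_)
open import Data.Fin.Subset using (Subset; _∈_; ∣_∣)
open import Data.Product using (_×_; _,_; ∃-syntax; Σ-syntax)
open import Relation.Nullary using (¬_; does)
open import Relation.Binary.PropositionalEquality using (_≡_; _≢_; refl)

record Graph (n : ℕ) : Set where
  field
    adj    : Fin n → Fin n → Bool
    sym    : ∀ u v → adj u v ≡ adj v u
    irrefl : ∀ v → adj v v ≡ false
open Graph public

data Walk {n : ℕ} (G : Graph n) : Fin n → Fin n → Set where
  here : ∀ {v} → Walk G v v
  step : ∀ {u v w} → adj G u v ≡ true → Walk G v w → Walk G u w

Connected : ∀ {n} → Graph n → Set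
Connected G = ∀ u v → Walk G u v

openN : ∀ {n} → Graph n → Fin n → Fin n → Bool
openN G v x = adj G v x

closedN : ∀ {n} → Graph n → Fin n → Fin n → Bool
closedN G v x = does (v ≟ x) ∨ adj G v x

TwinFree : ∀ {n} → Graph n → Set
TwinFree {n} G = ∀ (u v : Fin n) → u ≢ v →
  ¬ (∀ x → openN G u x ≡ openN G v x) × ¬ (∀ x → closedN G u x ≡ closedN G v x)

IsIDCode : ∀ {n} → Graph n → Subset n → Set
IsIDCode {n} G C =
  (∀ v → ∃[ x ] (x ∈ C × closedN G v x ≡ true)) ×
  (∀ (u v : Fin n) → u ≢ v →
     ¬ (∀ x → x ∈ C → closedN G u x ≡ closedN G v x))

IsIDNumber : ∀ {n} → Graph n → ℕ → Set
IsIDNumber {n} G g =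
  (∃[ C ] (IsIDCode G C × ∣ C ∣ ≡ g)) × (∀ C → IsIDCode G C → g ≤ ∣ C ∣)

-- Vertex set Fin (k * 3); a vertex w corresponds to the pair
-- remQuot 3 w = (i , j) with i ∈ V(H) and j ∈ Fin 3:
--   j = 0 : the original vertex i of H,
--   j = 1 : the end of the new P₂ attached to i,
--   j = 2 : the other end of that P₂.
coronaAdj : ∀ {k} → Graph k → Fin k × Fin 3 → Fin k × Fin 3 → Bool
coronaAdj H (i , zero) (i' , zero) = adj H i i'
coronaAdj H (i , zero) (i' , suc zero) = does (i ≟ i')
coronaAdj H (i , suc zero) (i' , zero) = does (i ≟ i')
coronaAdj H (i , suc zero) (i' , suc (suc zero)) = does (i ≟ i')
coronaAdj H (i , suc (suc zero)) (i' , suc zero) = does (i ≟ i')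
coronaAdj H _ _ = false

private
  ≟-sym : ∀ {k} (i i' : Fin k) → does (i ≟ i') ≡ does (i' ≟ i)
  ≟-sym i i' with i ≟ i' | i' ≟ i
  ... | Relation.Nullary.yes _ | Relation.Nullary.yes _ = refl
  ... | Relation.Nullary.no _  | Relation.Nullary.no _  = refl
  ... | Relation.Nullary.yes refl | Relation.Nullary.no q = Data.Empty.⊥-elim (q refl)
    where import Data.Empty
  ... | Relation.Nullary.no q | Relation.Nullary.yes refl = Data.Empty.⊥-elim (q refl)
    where import Data.Empty

  coronaAdj-sym : ∀ {k} (H : Graph k) p q → coronaAdj H p q ≡ coronaAdj H q p
  coronaAdj-sym H (i , zero) (i' , zero) = sym H i i'
  coronaAdj-sym H (i , zero) (i' , suc zero) = ≟-sym i i'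
  coronaAdj-sym H (i , zero) (i' , suc (suc zero)) = refl
  coronaAdj-sym H (i , suc zero) (i' , zero) = ≟-sym i i'
  coronaAdj-sym H (i , suc zero) (i' , suc zero) = refl
  coronaAdj-sym H (i , suc zero) (i' , suc (suc zero)) = ≟-sym i i'
  coronaAdj-sym H (i , suc (suc zero)) (i' , zero) = refl
  coronaAdj-sym H (i , suc (suc zero)) (i' , suc zero) = ≟-sym i i'
  coronaAdj-sym H (i , suc (suc zero)) (i' , suc (suc zero)) = refl

  coronaAdj-irr : ∀ {k} (H : Graph k) p → coronaAdj H p p ≡ false
  coronaAdj-irr H (i , zero) = irrefl H i
  coronaAdj-irr H (i , suc zero) = refl
  coronaAdj-irr H (i , suc (suc zero)) = refl

corona2 : ∀ {k} → Graph k → Graph (k * 3)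
corona2 H = record
  { adj    = λ u v → coronaAdj H (remQuot 3 u) (remQuot 3 v)
  ; sym    = λ u v → coronaAdj-sym H (remQuot 3 u) (remQuot 3 v)
  ; irrefl = λ v → coronaAdj-irr H (remQuot 3 v)
  }

-- Write v_i, a_i, b_i (= combine i 0, 1, 2) for the vertex i of H and the path a_i b_i
-- attached to it, so that N[a_i] = {v_i, a_i, b_i} is a whole block. Hence the code
-- {v_i, a_i : i ∈ V(H)} separates any two vertices of different blocks by an a_i; inside a
-- block, b_i is separated from v_i and a_i by v_i, and v_i from a_i by v_j for a neighbour
-- j of i, which exists because a connected graph of order at least 2 has no isolated vertex.
-- Conversely, v_i is the only vertex separating a_i from b_i, and b_i is dominated only
-- by a_i and b_i, so every identifying code meets each block in at least two vertices.
module Submission where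

open import Defs hiding (sym)
open import Data.Nat using (ℕ; zero; suc; _+_; _*_; _≤_; s≤s; z≤n)
open import Data.Nat.Properties using (*-suc; ≤-trans; m≤n⇒m≤1+n)
open import Data.Bool using (Bool; true; false; _∨_; _∧_)
open import Data.Bool.Properties using (∨-identityʳ; ∨-zeroʳ)
open import Data.Fin using (Fin; zero; suc; combine; _≟_)
open import Data.Fin.Properties using (remQuot-combine; combine-surjective; combine-injective)
open import Data.Fin.Subset using (Subset; _∈_; ∣_∣; inside; outside)
open import Data.Fin.Subset.Properties using (_∈?_; ∣p∣≤∣x∷p∣)
open import Data.Vec using ([]; _∷_; here; there)
open import Data.Unit using (⊤; tt)
open import Data.Product using (_×_; _,_; ∃-syntax; proj₁; proj₂)
open import Data.Sum using (_⊎_; inj₁; inj₂)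
open import Function using (_∘_)
open import Relation.Nullary using (¬_; does; yes; no; contradiction)
open import Relation.Nullary.Decidable using (dec-true; dec-false)
open import Relation.Binary.PropositionalEquality
  using (_≡_; _≢_; refl; sym; trans; cong; cong₂; subst; ≢-sym)

≟-self : ∀ {n} (i : Fin n) → does (i ≟ i) ≡ true
≟-self i = dec-true (i ≟ i) refl

≟-≢ : ∀ {n} {i j : Fin n} → i ≢ j → does (i ≟ j) ≡ false
≟-≢ {i = i} {j} = dec-false (i ≟ j)

differ-at : ∀ {A : Set} {P : A → Set} {f g : A → Bool} x → P x →
  f x ≡ true → g x ≡ false → ¬ (∀ y → P y → f y ≡ g y)
differ-at x px fx≡true gx≡false same =
  contradiction (trans (sym fx≡true) (trans (same x px) gx≡false)) λ ()

∀-combine : ∀ {m n} {P : Fin (m * n) → Set} →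
  (∀ (i : Fin m) (j : Fin n) → P (combine i j)) → ∀ u → P u
∀-combine {m} {n} f u with combine-surjective {m} {n} u
... | i , j , refl = f i j

does-combine-≟ : ∀ {m n} (i a : Fin m) (j b : Fin n) →
  does (combine i j ≟ combine a b) ≡ does (j ≟ b) ∧ does (i ≟ a)
does-combine-≟ i a j b with combine i j ≟ combine a b
... | yes cij≡cab with combine-injective i j a b cij≡cab
...   | refl , refl = sym (cong₂ _∧_ (≟-self j) (≟-self i))
does-combine-≟ i a j b | no cij≢cab with j ≟ b | i ≟ a
... | yes refl | yes refl = contradiction refl cij≢cab
... | yes _    | no _     = refl
... | no _     | _        = refl

adj⇒≢ : ∀ {n} {G : Graph n} {u v} → adj G u v ≡ true → u ≢ v
adj⇒≢ {G = G} {u} uv refl = contradiction (trans (sym uv) (irrefl G u)) λ ()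

NoIsolatedVertex : ∀ {n} → Graph n → Set
NoIsolatedVertex {n} G = ∀ v → ∃[ w ] adj G v w ≡ true

walk-first-step : ∀ {n} {G : Graph n} {u v} → Walk G u v → u ≢ v → ∃[ w ] adj G u w ≡ true
walk-first-step here              u≢u = contradiction refl u≢u
walk-first-step (step {v = w} e _) _  = w , e

another-vertex : ∀ {n} → 2 ≤ n → (v : Fin n) → ∃[ w ] v ≢ w
another-vertex (s≤s (s≤s z≤n)) zero    = suc zero , λ ()
another-vertex (s≤s (s≤s z≤n)) (suc _) = zero , λ ()

connected⇒noIsolatedVertex : ∀ {n} {G : Graph n} → 2 ≤ n → Connected G → NoIsolatedVertex G
connected⇒noIsolatedVertex 2≤n conn v =
  let w , v≢w = another-vertex 2≤n v in walk-first-step (conn v w) v≢w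

idCode⇒no-closed-twins : ∀ {n} (G : Graph n) {C} → IsIDCode G C → ∀ u v → u ≢ v →
  ¬ (∀ x → closedN G u x ≡ closedN G v x)
idCode⇒no-closed-twins G (_ , separates) u v u≢v twins = separates u v u≢v λ x _ → twins x

TwoInBlock : ∀ {k} → Subset (k * 3) → Fin k → Set
TwoInBlock C i = combine i zero ∈ C × (combine i (suc zero) ∈ C ⊎ combine i (suc (suc zero)) ∈ C)

∣∣-twoInEveryBlock : ∀ k (C : Subset (k * 3)) → (∀ (i : Fin k) → TwoInBlock C i) → 2 * k ≤ ∣ C ∣
∣∣-twoInEveryBlock zero    []                two = z≤n
∣∣-twoInEveryBlock (suc k) (a ∷ b ∷ d ∷ C) two =
  subst (_≤ ∣ a ∷ b ∷ d ∷ C ∣) (sym (*-suc 2 k))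
    (first-block (two zero) (∣∣-twoInEveryBlock k C (tail-block ∘ two ∘ suc)))
  where
  tail-block : ∀ {i : Fin k} → TwoInBlock (a ∷ b ∷ d ∷ C) (suc i) → TwoInBlock C i
  tail-block (there (there (there v∈C)) , inj₁ (there (there (there x∈C)))) = v∈C , inj₁ x∈C
  tail-block (there (there (there v∈C)) , inj₂ (there (there (there y∈C)))) = v∈C , inj₂ y∈C

  first-block : TwoInBlock {suc k} (a ∷ b ∷ d ∷ C) zero → 2 * k ≤ ∣ C ∣ → 2 + 2 * k ≤ ∣ a ∷ b ∷ d ∷ C ∣
  first-block (here , inj₁ (there here)) le = s≤s (s≤s (≤-trans le (∣p∣≤∣x∷p∣ d C)))
  first-block (here , inj₂ (there (there here))) le = s≤s (≤-trans (s≤s le) (∣p∣≤∣x∷p∣ b (inside ∷ C)))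

corona-code : ∀ k → Subset (k * 3)
corona-code zero    = []
corona-code (suc k) = inside ∷ inside ∷ outside ∷ corona-code k

∣corona-code∣ : ∀ k → ∣ corona-code k ∣ ≡ 2 * k
∣corona-code∣ zero    = refl
∣corona-code∣ (suc k) = trans (cong (2 +_) (∣corona-code∣ k)) (sym (*-suc 2 k))

v∈corona-code : ∀ {k} (i : Fin k) → combine i zero ∈ corona-code k
v∈corona-code zero    = here
v∈corona-code (suc i) = there (there (there (v∈corona-code i)))

a∈corona-code : ∀ {k} (i : Fin k) → combine i (suc zero) ∈ corona-code k
a∈corona-code zero    = there here
a∈corona-code (suc i) = there (there (there (a∈corona-code i)))

module Corona {k : ℕ} (H : Graph k) where

  G : Graph (k * 3)
  G = corona2 H

  SameTrace : Subset (k * 3) → Fin (k * 3) → Fin (k * 3) → Set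
  SameTrace C u v = ∀ x → x ∈ C → closedN G u x ≡ closedN G v x

  combine≢⇒≢ : ∀ {i i' : Fin k} {j : Fin 3} → combine i j ≢ combine i' j → i' ≢ i
  combine≢⇒≢ {j = j} cij≢ci'j i'≡i = cij≢ci'j (cong (λ z → combine z j) (sym i'≡i))

  -- Comparing the positions j, b first makes this compute when they are literals.
  coronaClosedN : Fin k × Fin 3 → Fin k × Fin 3 → Bool
  coronaClosedN (i , j) (a , b) = (does (j ≟ b) ∧ does (i ≟ a)) ∨ coronaAdj H (i , j) (a , b)

  adj-combine : ∀ i j a b → adj G (combine i j) (combine a b) ≡ coronaAdj H (i , j) (a , b)
  adj-combine i j a b rewrite remQuot-combine {k} {3} i j | remQuot-combine {k} {3} a b = refl

  closedN-combine : ∀ i j a b → closedN G (combine i j) (combine a b) ≡ coronaClosedN (i , j) (a , b)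
  closedN-combine i j a b = cong₂ _∨_ (does-combine-≟ i a j b) (adj-combine i j a b)

  coronaClosedN-a : ∀ i' j' i → coronaClosedN (i' , j') (i , suc zero) ≡ does (i' ≟ i)
  coronaClosedN-a i' zero             i = refl
  coronaClosedN-a i' (suc zero)       i = ∨-identityʳ _
  coronaClosedN-a i' (suc (suc zero)) i = refl

  open-neighbourhoods-differ-at : ∀ {i j i' j'} a b →
    coronaAdj H (i , j) (a , b) ≡ true → coronaAdj H (i' , j') (a , b) ≡ false →
    ¬ (∀ x → openN G (combine i j) x ≡ openN G (combine i' j') x)
  open-neighbourhoods-differ-at {i} {j} {i'} {j'} a b ij~ab i'j'≁ab twins =
    differ-at {P = λ _ → ⊤} (combine a b) tt
      (trans (adj-combine i j a b) ij~ab) (trans (adj-combine i' j' a b) i'j'≁ab) (λ x _ → twins x)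

  traces-differ-at : ∀ {C i j i' j'} a b → combine a b ∈ C →
    coronaClosedN (i , j) (a , b) ≡ true → coronaClosedN (i' , j') (a , b) ≡ false →
    ¬ SameTrace C (combine i j) (combine i' j')
  traces-differ-at {i = i} {j} {i'} {j'} a b ab∈C ij∼ab i'j'≁ab =
    differ-at (combine a b) ab∈C
      (trans (closedN-combine i j a b) ij∼ab) (trans (closedN-combine i' j' a b) i'j'≁ab)

  traces-agree : ∀ {C i j i' j'} →
    (∀ a b → combine a b ∈ C → coronaClosedN (i , j) (a , b) ≡ coronaClosedN (i' , j') (a , b)) →
    SameTrace C (combine i j) (combine i' j')
  traces-agree {i = i} {j} {i'} {j'} agree = ∀-combine λ a b ab∈C →
    trans (closedN-combine i j a b) (trans (agree a b ab∈C) (sym (closedN-combine i' j' a b)))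

  no-open-twins-combine : NoIsolatedVertex H → ∀ (i : Fin k) (j : Fin 3) (i' : Fin k) (j' : Fin 3) →
    combine i j ≢ combine i' j' →
    ¬ (∀ x → openN G (combine i j) x ≡ openN G (combine i' j') x)
  no-open-twins-combine nb i zero i' zero ne =
    open-neighbourhoods-differ-at i (suc zero) (≟-self i) (≟-≢ (combine≢⇒≢ ne))
  no-open-twins-combine nb i (suc zero) i' (suc zero) ne =
    open-neighbourhoods-differ-at i zero (≟-self i) (≟-≢ (combine≢⇒≢ ne))
  no-open-twins-combine nb i (suc (suc zero)) i' (suc (suc zero)) ne =
    open-neighbourhoods-differ-at i (suc zero) (≟-self i) (≟-≢ (combine≢⇒≢ ne))
  no-open-twins-combine nb i zero i' (suc (suc zero)) ne =
    open-neighbourhoods-differ-at (proj₁ (nb i)) zero (proj₂ (nb i)) refl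
  no-open-twins-combine nb i (suc zero) i' zero ne =
    open-neighbourhoods-differ-at i (suc (suc zero)) (≟-self i) refl
  no-open-twins-combine nb i (suc zero) i' (suc (suc zero)) ne =
    open-neighbourhoods-differ-at i zero (≟-self i) refl
  no-open-twins-combine nb i zero i' (suc zero) ne twins =
    no-open-twins-combine nb i' (suc zero) i zero (≢-sym ne) (λ x → sym (twins x))
  no-open-twins-combine nb i (suc (suc zero)) i' zero ne twins =
    no-open-twins-combine nb i' zero i (suc (suc zero)) (≢-sym ne) (λ x → sym (twins x))
  no-open-twins-combine nb i (suc (suc zero)) i' (suc zero) ne twins =
    no-open-twins-combine nb i' (suc zero) i (suc (suc zero)) (≢-sym ne) (λ x → sym (twins x))

  no-open-twins : NoIsolatedVertex H → ∀ u v → u ≢ v → ¬ (∀ x → openN G u x ≡ openN G v x)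
  no-open-twins nb = ∀-combine λ i j → ∀-combine λ i' j' → no-open-twins-combine nb i j i' j'

  corona-code-separates-block : NoIsolatedVertex H → ∀ (i : Fin k) (j j' : Fin 3) → j ≢ j' →
    ¬ SameTrace (corona-code k) (combine i j) (combine i j')
  corona-code-separates-block nb i zero zero j≢j' = contradiction refl j≢j'
  corona-code-separates-block nb i (suc zero) (suc zero) j≢j' = contradiction refl j≢j'
  corona-code-separates-block nb i (suc (suc zero)) (suc (suc zero)) j≢j' = contradiction refl j≢j'
  corona-code-separates-block nb i zero (suc zero) _ =
    let n , i~n = nb i in
    traces-differ-at n zero (v∈corona-code n)
      (trans (cong (does (i ≟ n) ∨_) i~n) (∨-zeroʳ _)) (≟-≢ (adj⇒≢ {G = H} i~n))
  corona-code-separates-block nb i zero (suc (suc zero)) _ =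
    traces-differ-at i zero (v∈corona-code i) (cong (_∨ adj H i i) (≟-self i)) refl
  corona-code-separates-block nb i (suc zero) (suc (suc zero)) _ =
    traces-differ-at i zero (v∈corona-code i) (≟-self i) refl
  corona-code-separates-block nb i (suc zero) zero j≢j' same =
    corona-code-separates-block nb i zero (suc zero) (≢-sym j≢j') (λ x x∈C → sym (same x x∈C))
  corona-code-separates-block nb i (suc (suc zero)) zero j≢j' same =
    corona-code-separates-block nb i zero (suc (suc zero)) (≢-sym j≢j') (λ x x∈C → sym (same x x∈C))
  corona-code-separates-block nb i (suc (suc zero)) (suc zero) j≢j' same =
    corona-code-separates-block nb i (suc zero) (suc (suc zero)) (≢-sym j≢j') (λ x x∈C → sym (same x x∈C))

  corona-code-separates : NoIsolatedVertex H → ∀ u v → u ≢ v → ¬ SameTrace (corona-code k) u v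
  corona-code-separates nb = ∀-combine λ i j → ∀-combine λ i' j' → separate i j i' j'
    where
    separate : ∀ (i : Fin k) j i' j' → combine i j ≢ combine i' j' →
      ¬ SameTrace (corona-code k) (combine i j) (combine i' j')
    separate i j i' j' ne with i ≟ i'
    ... | yes refl = corona-code-separates-block nb i j j' (ne ∘ cong (combine i))
    ... | no i≢i' = traces-differ-at i (suc zero) (a∈corona-code i)
      (trans (coronaClosedN-a i j i) (≟-self i)) (trans (coronaClosedN-a i' j' i) (≟-≢ (≢-sym i≢i')))

  corona-code-dominates : ∀ u → ∃[ x ] (x ∈ corona-code k × closedN G u x ≡ true)
  corona-code-dominates = ∀-combine λ i j →
    combine i (suc zero) , a∈corona-code i ,
    trans (closedN-combine i j i (suc zero)) (trans (coronaClosedN-a i j i) (≟-self i))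

  corona-code-isIDCode : NoIsolatedVertex H → IsIDCode G (corona-code k)
  corona-code-isIDCode nb = corona-code-dominates , corona-code-separates nb

  idCode∋v : ∀ {C} → IsIDCode G C → ∀ i → combine i zero ∈ C
  idCode∋v {C} (_ , separates) i with combine i zero ∈? C
  ... | yes v∈C = v∈C
  ... | no  v∉C = contradiction (traces-agree agree) (separates _ _ a≢b)
    where
    a≢b : combine i (suc zero) ≢ combine i (suc (suc zero))
    a≢b eq = contradiction (proj₂ (combine-injective i (suc zero) i (suc (suc zero)) eq)) λ ()

    agree : ∀ a b → combine a b ∈ C →
      coronaClosedN (i , suc zero) (a , b) ≡ coronaClosedN (i , suc (suc zero)) (a , b)
    agree a zero v∈C with i ≟ a
    ... | yes refl = contradiction v∈C v∉C
    ... | no  _    = refl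
    agree a (suc zero)       _ = ∨-identityʳ _
    agree a (suc (suc zero)) _ = sym (∨-identityʳ _)

  idCode∋a⊎b : ∀ {C} → IsIDCode G C → ∀ i → combine i (suc zero) ∈ C ⊎ combine i (suc (suc zero)) ∈ C
  idCode∋a⊎b {C} (dominates , _) i with dominates (combine i (suc (suc zero)))
  ... | x , x∈C , b∼x with combine-surjective {k} {3} x
  ...   | a , b , refl = dominator a b x∈C (trans (sym (closedN-combine i _ a b)) b∼x)
    where
    dominator : ∀ a b → combine a b ∈ C → coronaClosedN (i , suc (suc zero)) (a , b) ≡ true →
      combine i (suc zero) ∈ C ⊎ combine i (suc (suc zero)) ∈ C
    dominator a zero _ ()
    dominator a (suc zero) ab∈C b∼ab with i ≟ a
    ... | yes refl = inj₁ ab∈C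
    ... | no  _    = contradiction b∼ab λ ()
    dominator a (suc (suc zero)) ab∈C b∼ab with i ≟ a
    ... | yes refl = inj₂ ab∈C
    ... | no  _    = contradiction b∼ab λ ()

  idCode-twoInBlock : ∀ {C} → IsIDCode G C → ∀ i → TwoInBlock C i
  idCode-twoInBlock isID i = idCode∋v isID i , idCode∋a⊎b isID i

proposition9 : ∀ (k : ℕ) (H : Graph k) → 2 ≤ k → Connected H →
    TwinFree (corona2 H) × IsIDNumber (corona2 H) (2 * k)
proposition9 k H 2≤k connected =
  twinFree , (corona-code k , code-isIDCode , ∣corona-code∣ k) , lower-bound
  where
  open Corona H
  noIsolated : NoIsolatedVertex H
  noIsolated = connected⇒noIsolatedVertex 2≤k connected

  code-isIDCode : IsIDCode G (corona-code k)
  code-isIDCode = corona-code-isIDCode noIsolated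

  twinFree : TwinFree G
  twinFree u v u≢v = no-open-twins noIsolated u v u≢v , idCode⇒no-closed-twins G code-isIDCode u v u≢v

  lower-bound : ∀ C → IsIDCode G C → 2 * k ≤ ∣ C ∣
  lower-bound C isID = ∣∣-twoInEveryBlock k C (idCode-twoInBlock isID)
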